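{- Let $D=(V,A)$ be an instance of Undirected Reachability Graph Realizability with solid graph $G$, and let $v$ and $w$ be two vertices of degree $1$ in $G$ that are both adjacent to the same vertex $u$ in $G$ and satisfy $(v,w)\notin A$ and $(w,v)\notin A$. For all non-strict variants (Any-Non-strict, Simple-Non-strict, and also Proper and Happy), $D$ is a no-instance. For the variants Any-Strict and Simple-Strict: if $D_{vx}=D_{wx}$ and $D_{xv}=D_{xw}$ hold for all $x\in V\setminus\{v,w\}$, then $D$ is realizable if and only if the instance $D'$ obtained from $D$ by deleting $v$ is realizable; otherwise $D$ is a no-instance.
   Context: An undirected temporal graph is a pair $(G,\lambda)$ with $G=(V,E)$ a simple undirected graph and $\lambda:E\to 2^{\mathbb{N}}$ assigning each edge a finite, possibly empty, set of labels. A strict (resp. non-strict) temporal path from $u$ to $v$ is a sequence $(e_1,t_1),\dots,(e_\ell,t_\ell)$, $t_j\in\lambda(e_j)$, such that $e_1,\dots,e_\ell$ form a $u$-$v$ path and $t_1<\dots<t_\ell$ (resp. $t_1\le\dots\le t_\ell$); the reachability graph is the digraph on $V$ with arc $(u,v)$, $u\ne v$, iff such a path exists. A labeling is proper if no two edges sharing an endpoint share a label, simple if every edge with nonempty label set has exactly one label, happy if both (for proper labelings strict and non-strict reachability coincide). Undirected Reachability Graph Realizability: given a simple digraph $D=(V,A)$, decide whether some undirected temporal graph on $V$ has reachability graph equal to $D$; variants X-Strict/X-Non-strict (strict/non-strict reachability, X = Any for arbitrary or X = Simple for simple labelings), Proper, Happy. Write $D_{xy}=1$ iff $(x,y)\in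 A$, else $0$. The solid graph $G$ of $D$ has vertex set $V$ and edges $\{u,v\}$ with $D_{uv}=D_{vu}=1$. -}

module Defs where

open import Data.Nat using (ℕ; _<_; _≤_)
open import Data.Bool using (Bool; true; false; _∧_)
open import Data.Fin using (Fin; punchIn)
open import Data.List using (List; []; _∷_; length; filter; allFin)
open import Data.List.Membership.Propositional using (_∈_)
open import Data.List.Relation.Unary.Unique.Propositional using (Unique)
open import Data.Product using (Σ; _×_; ∃)
open import Data.Unit using (⊤)
open import Data.Empty using (⊥)
open import Relation.Binary.PropositionalEquality using (_≡_; _≢_)
open import Relation.Nullary using (¬_)
open import Function.Bundles using (_⇔_)
open import Data.Bool.Properties using (T?)
open import Data.Bool using (T)

Digraph : ℕ → Set
Digraph n = Fin n → Fin n → Bool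

-- Simple digraph: no loops (no multiple arcs by construction).
IsSimpleDigraph : ∀ {n} → Digraph n → Set
IsSimpleDigraph D = ∀ x → D x x ≡ false

-- Undirected temporal graph on Fin n: lab u v is the (finite) label set of the
-- edge {u,v}, represented as a list; the edge is absent/unlabelled iff the set is empty.
record TemporalGraph (n : ℕ) : Set where
  field
    lab      : Fin n → Fin n → List ℕ
    lab-sym  : ∀ u v → lab u v ≡ lab v u
    loopless : ∀ u → lab u u ≡ []
open TemporalGraph public

-- Temporal walk from u to v whose first edge has label t, visiting the vertex list vs,
-- with consecutive labels related by _≺_ (_<_ strict, _≤_ non-strict).
data TWalk {n : ℕ} (𝒢 : TemporalGraph n) (_≺_ : ℕ → ℕ → Set)
     : Fin n → Fin n → ℕ → List (Fin n) → Set where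
  one  : ∀ {u w t} → t ∈ lab 𝒢 u w → TWalk 𝒢 _≺_ u w t (u ∷ w ∷ [])
  cons : ∀ {u w v t t' vs} → t ∈ lab 𝒢 u w → t ≺ t' →
         TWalk 𝒢 _≺_ w v t' vs → TWalk 𝒢 _≺_ u v t (u ∷ vs)

TPath : ∀ {n} → TemporalGraph n → (ℕ → ℕ → Set) → Fin n → Fin n → Set
TPath 𝒢 _≺_ u v = Σ ℕ λ t → Σ (List _) λ vs → TWalk 𝒢 _≺_ u v t vs × Unique vs

ReachArc : ∀ {n} → TemporalGraph n → (ℕ → ℕ → Set) → Fin n → Fin n → Set
ReachArc 𝒢 _≺_ u v = u ≢ v × TPath 𝒢 _≺_ u v

HasReachGraph : ∀ {n} → TemporalGraph n → (ℕ → ℕ → Set) → Digraph n → Set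
HasReachGraph 𝒢 _≺_ D = ∀ u v → (D u v ≡ true ⇔ ReachArc 𝒢 _≺_ u v)

IsSimpleLabeling : ∀ {n} → TemporalGraph n → Set
IsSimpleLabeling 𝒢 = ∀ u v t t' → t ∈ lab 𝒢 u v → t' ∈ lab 𝒢 u v → t ≡ t'

IsProperLabeling : ∀ {n} → TemporalGraph n → Set
IsProperLabeling 𝒢 = ∀ u v w t → v ≢ w → t ∈ lab 𝒢 u v → t ∈ lab 𝒢 u w → ⊥

IsHappyLabeling : ∀ {n} → TemporalGraph n → Set
IsHappyLabeling 𝒢 = IsProperLabeling 𝒢 × IsSimpleLabeling 𝒢

data Kind : Set where
  Any Simple : Kind

data Variant : Set where
  strict nonStrict : Kind → Variant
  proper happy     : Variant

KindOK : ∀ {n} → Kind → TemporalGraph n → Set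
KindOK Any    𝒢 = ⊤
KindOK Simple 𝒢 = IsSimpleLabeling 𝒢

LabelingOK : ∀ {n} → Variant → TemporalGraph n → Set
LabelingOK (strict k)    𝒢 = KindOK k 𝒢
LabelingOK (nonStrict k) 𝒢 = KindOK k 𝒢
LabelingOK proper        𝒢 = IsProperLabeling 𝒢
LabelingOK happy         𝒢 = IsHappyLabeling 𝒢

-- Time ordering along paths (for proper/happy, strict and non-strict coincide;
-- we use non-strict).
Order : Variant → ℕ → ℕ → Set
Order (strict k)    = _<_
Order (nonStrict k) = _≤_
Order proper        = _≤_
Order happy         = _≤_

Realizable : ∀ {n} → Variant → Digraph n → Set
Realizable {n} var D =
  Σ (TemporalGraph n) λ 𝒢 → LabelingOK var 𝒢 × HasReachGraph 𝒢 (Order var) D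

SolidEdge : ∀ {n} → Digraph n → Fin n → Fin n → Set
SolidEdge D u v = D u v ≡ true × D v u ≡ true

solidDegree : ∀ {n} → Digraph n → Fin n → ℕ
solidDegree {n} D v = length (filter (λ x → T? (D v x ∧ D x v)) (allFin n))

deleteVertex : ∀ {m} → Digraph (Data.Nat.suc m) → Fin (Data.Nat.suc m) → Digraph m
deleteVertex D v x y = D (punchIn v x) (punchIn v y)

Twins : ∀ {n} → Digraph n → Fin n → Fin n → Set
Twins D v w = ∀ x → x ≢ v → x ≢ w → (D v x ≡ D w x) × (D x v ≡ D x w)

module Submission where

-- Let t ∈ λ(vu) and t' ∈ λ(wu). If t ≺ t' then v u w is a temporal path, so (v,w) ∈ A; hence the
-- labels of vu and wu are pairwise incomparable. For a total order (the non-strict, proper and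
-- happy variants) this is absurd. For < it forces λ(vu) and λ(wu) to be one and the same singleton,
-- so transposing v and w preserves all labels: v and w are twins, and since a leaf is never
-- interior to a path, deleting v leaves the other reachabilities unchanged. Conversely, from a
-- strict realization of D − v we first make the edge w u carry a single label: with l₁, lₖ the
-- least and greatest labels of wu, double every other label and put l₁ + lₖ on wu. A path leaving w
-- continues from u at a time t' with l₁ < t' and lₖ ≤ t', and a path entering w reaches u at a time
-- t with t ≤ l₁ and t < lₖ (the bounds lₖ ≤ t' and t ≤ l₁ hold because otherwise the vertex next to
-- u would be a second solid neighbour of w), so 2t < l₁ + lₖ < 2t'. Then v is attached to u as an
-- exact copy of w.

open import Defs
open import Data.Bool using (Bool; true; false; _∧_; T)
open import Data.Bool.Properties using (T?)
open import Data.Empty using (⊥-elim)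
open import Data.Fin using (Fin; punchIn; punchOut)
open import Data.Fin.Properties using (_≟_; punchInᵢ≢i; punchIn-punchOut; punchOut-punchIn; punchOut-cong)
open import Data.Fin.Permutation.Components using (transpose; transpose-inverse)
open import Data.List using (List; []; _∷_; map; filter; length; allFin)
open import Data.List.Properties using (map-id; map-∘; map-id-local)
open import Data.List.Membership.Propositional using (_∈_)
open import Data.List.Membership.Propositional.Properties using (∈-map⁺; ∈-map⁻; ∈-filter⁺; ∈-allFin)
open import Data.List.Relation.Unary.Any using (here; there)
open import Data.List.Relation.Unary.All as All using (All; []; _∷_)
open import Data.List.Relation.Unary.All.Properties using (¬Any⇒All¬)
open import Data.List.Relation.Unary.AllPairs using ([]; _∷_)
open import Data.List.Relation.Unary.Unique.Propositional using (Unique)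
open import Data.List.Relation.Unary.Unique.Propositional.Properties using (map⁻)
open import Data.Nat using (ℕ; suc; _<_; _≤_; _+_)
open import Data.Nat.Properties
  using (≤-totalOrder; ≤-total; ≤-reflexive; <⇒≤; <⇒≱; ≰⇒>; ≮⇒≥; <-cmp; ≤-<-trans; <-≤-trans;
         +-mono-≤; +-mono-<; +-mono-<-≤; +-mono-≤-<; +-monoˡ-≤; +-monoʳ-≤)
open import Data.List.Extrema ≤-totalOrder using (min; max; argmin-sel; argmax-sel; min≤xs; xs≤max)
open import Data.Product using (∃; _×_; _,_; proj₁; proj₂)
open import Data.Sum using (_⊎_; inj₁; inj₂; [_,_]′)
open import Data.Unit using (tt)
open import Function using (_∘_; id)
open import Function.Bundles using (_⇔_; mk⇔; Equivalence)
open import Function.Properties.Equivalence using () renaming (trans to ⇔-trans; sym to ⇔-sym)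
open import Relation.Binary.Definitions using (tri<; tri≈; tri>)
open import Relation.Binary.PropositionalEquality using (_≡_; _≢_; refl; sym; trans; cong; cong₂; subst; subst₂)
open import Relation.Nullary using (¬_; Dec; yes; no)
open import Relation.Nullary.Decidable using (dec-true; dec-false)
open import Relation.Unary using (U)

Pendant : ∀ {n} → TemporalGraph n → Fin n → Fin n → Set
Pendant 𝒢 z c = ∀ {y t} → t ∈ lab 𝒢 z y → y ≡ c

module _ {n} (𝒢 : TemporalGraph n) where

  ∈-lab-sym : ∀ {a b t} → t ∈ lab 𝒢 a b → t ∈ lab 𝒢 b a
  ∈-lab-sym {a} {b} = subst (_ ∈_) (lab-sym 𝒢 a b)

  ∈-lab⇒≢ : ∀ {a b t} → t ∈ lab 𝒢 a b → a ≢ b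
  ∈-lab⇒≢ {a} {t = t} p refl with () ← subst (t ∈_) (loopless 𝒢 a) p

  module _ (_≺_ : ℕ → ℕ → Set) where

    edge⇒reach : ∀ {a b t} → t ∈ lab 𝒢 a b → ReachArc 𝒢 _≺_ a b
    edge⇒reach p = ∈-lab⇒≢ p , _ , _ , one p , (∈-lab⇒≢ p ∷ []) ∷ [] ∷ []

    twoEdges⇒reach : ∀ {a b c t t'} → t ∈ lab 𝒢 a b → t ≺ t' → t' ∈ lab 𝒢 b c → a ≢ c →
                     ReachArc 𝒢 _≺_ a c
    twoEdges⇒reach p t≺t' q a≢c =
      a≢c , _ , _ , cons p t≺t' (one q) , (∈-lab⇒≢ p ∷ a≢c ∷ []) ∷ (∈-lab⇒≢ q ∷ []) ∷ [] ∷ []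

module _ {n} {𝒢 : TemporalGraph n} {_≺_ : ℕ → ℕ → Set} where

  source∈ : ∀ {a b t vs} → TWalk 𝒢 _≺_ a b t vs → a ∈ vs
  source∈ (one _)      = here refl
  source∈ (cons _ _ _) = here refl

  target∈ : ∀ {a b t vs} → TWalk 𝒢 _≺_ a b t vs → b ∈ vs
  target∈ (one _)         = there (here refl)
  target∈ (cons _ _ rest) = there (target∈ rest)

  firstEdge : ∀ {a b t vs} → TWalk 𝒢 _≺_ a b t vs → ∃ λ y → t ∈ lab 𝒢 a y × y ∈ vs
  firstEdge (one p)         = _ , p , there (here refl)
  firstEdge (cons p _ rest) = _ , p , there (source∈ rest)

  endpoints-≢ : ∀ {a b t vs} → TWalk 𝒢 _≺_ a b t vs → Unique vs → a ≢ b
  endpoints-≢ (one p)         _          = ∈-lab⇒≢ 𝒢 p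
  endpoints-≢ (cons _ _ rest) (a∉ ∷ _) = All.lookup a∉ (target∈ rest)

  pendant-endpoint : ∀ {z c a b t vs} → Pendant 𝒢 z c → TWalk 𝒢 _≺_ a b t vs → Unique vs →
                     z ∈ vs → z ≡ a ⊎ z ≡ b
  pendant-endpoint _ (one _)      _ (here z≡a)         = inj₁ z≡a
  pendant-endpoint _ (one _)      _ (there (here z≡b)) = inj₂ z≡b
  pendant-endpoint _ (cons _ _ _) _ (here z≡a)         = inj₁ z≡a
  pendant-endpoint z-pendant (cons p _ rest) (a∉ ∷ un) (there z∈) with pendant-endpoint z-pendant rest un z∈
  ... | inj₂ z≡b  = inj₂ z≡b
  ... | inj₁ refl with firstEdge rest
  ...   | y , q , y∈ = ⊥-elim (All.lookup a∉ y∈ (trans (z-pendant (∈-lab-sym 𝒢 p)) (sym (z-pendant q))))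

  pendant-avoided : ∀ {z c a b t vs} → Pendant 𝒢 z c → TWalk 𝒢 _≺_ a b t vs → Unique vs →
                    z ≢ a → z ≢ b → All (z ≢_) vs
  pendant-avoided z-pendant wk un z≢a z≢b =
    ¬Any⇒All¬ _ (λ z∈ → [ z≢a , z≢b ]′ (pendant-endpoint z-pendant wk un z∈))

Unique-map-leftInverse : ∀ {A B : Set} {f : A → B} (g : B → A) {xs : List A} →
              All (λ x → g (f x) ≡ x) xs → Unique xs → Unique (map f xs)
Unique-map-leftInverse {f = f} g {xs} g∘f un =
  map⁻ {f = g} (subst Unique (sym (trans (sym (map-∘ xs)) (map-id-local g∘f))) un)

module _ {n n'} {G : TemporalGraph n} {H : TemporalGraph n'} {_≺_ _≺'_ : ℕ → ℕ → Set}
         (f : Fin n → Fin n') {P : Fin n → Set} {R : ℕ → ℕ → Set}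
         (lab-map : ∀ {a b t} → P a → P b → t ∈ lab G a b → ∃ λ t' → R t t' × t' ∈ lab H (f a) (f b))
         (≺-map : ∀ {t₁ t₂ t₁' t₂'} → R t₁ t₁' → R t₂ t₂' → t₁ ≺ t₂ → t₁' ≺' t₂') where

  mapTWalk : ∀ {a b t vs} → TWalk G _≺_ a b t vs → All P vs →
             ∃ λ t' → R t t' × TWalk H _≺'_ (f a) (f b) t' (map f vs)
  mapTWalk (one p) (pa ∷ pb ∷ []) with lab-map pa pb p
  ... | t' , r , q = t' , r , one q
  mapTWalk (cons p t≺ rest) (pa ∷ ps) with mapTWalk rest ps | lab-map pa (All.lookup ps (source∈ rest)) p
  ... | t₂' , r₂ , rest' | t' , r , q = t' , r , cons q (≺-map r r₂ t≺) rest'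

module _ {n n'} {G : TemporalGraph n} {H : TemporalGraph n'} {_≺_ : ℕ → ℕ → Set}
         (f : Fin n → Fin n') (g : Fin n' → Fin n) {P : Fin n → Set}
         (g∘f : ∀ {a} → P a → g (f a) ≡ a)
         (lab-map : ∀ {a b t} → P a → P b → t ∈ lab G a b → t ∈ lab H (f a) (f b)) where

  mapPath : ∀ {a b t vs} → TWalk G _≺_ a b t vs → Unique vs → All P vs → ReachArc H _≺_ (f a) (f b)
  mapPath wk un ps
    with mapTWalk f {R = _≡_} (λ pa pb p → _ , refl , lab-map pa pb p) (λ { refl refl t≺ → t≺ }) wk ps
  ... | t' , _ , wk' = fa≢fb , t' , _ , wk' , Unique-map-leftInverse g (All.map g∘f ps) un
    where
    fa≢fb : f _ ≢ f _
    fa≢fb fa≡fb = endpoints-≢ wk un (trans (sym (g∘f (All.lookup ps (source∈ wk))))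
                                    (trans (cong g fa≡fb) (g∘f (All.lookup ps (target∈ wk)))))

module Realization {n} {D : Digraph n} {𝒢 : TemporalGraph n} {_≺_ : ℕ → ℕ → Set}
                   (realizes : HasReachGraph 𝒢 _≺_ D) where

  reach⇒arc : ∀ {a b} → ReachArc 𝒢 _≺_ a b → D a b ≡ true
  reach⇒arc = Equivalence.from (realizes _ _)

  arc⇒reach : ∀ {a b} → D a b ≡ true → ReachArc 𝒢 _≺_ a b
  arc⇒reach = Equivalence.to (realizes _ _)

  edge⇒arc : ∀ {a b t} → t ∈ lab 𝒢 a b → D a b ≡ true
  edge⇒arc p = reach⇒arc (edge⇒reach 𝒢 _≺_ p)

  solid⇒pendant : ∀ {z c} → (∀ {x} → SolidEdge D z x → x ≡ c) → Pendant 𝒢 z c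
  solid⇒pendant only-c p = only-c (edge⇒arc p , edge⇒arc (∈-lab-sym 𝒢 p))

  pendant-arc⇒label : ∀ {a b} → Pendant 𝒢 a b → D a b ≡ true → ∃ λ t → t ∈ lab 𝒢 a b
  pendant-arc⇒label a-pendant ab with Equivalence.to (realizes _ _) ab
  ... | _ , t , _ , wk , _ with firstEdge wk
  ...   | _ , p , _ = t , subst (λ y → t ∈ lab 𝒢 _ y) (a-pendant p) p

∈-length1 : ∀ {A : Set} {xs : List A} {x y : A} → length xs ≡ 1 → x ∈ xs → y ∈ xs → x ≡ y
∈-length1 {xs = _ ∷ []} _ (here refl) (here refl) = refl

solidDegree1⇒unique : ∀ {n} (D : Digraph n) {z c} → solidDegree D z ≡ 1 → SolidEdge D z c →
                      ∀ {x} → SolidEdge D z x → x ≡ c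
solidDegree1⇒unique {n} D {z} deg zc zx = ∈-length1 deg (solid∈ zx) (solid∈ zc)
  where
  solid? = λ y → T? (D z y ∧ D y z)
  solid∈ : ∀ {y} → SolidEdge D z y → y ∈ filter solid? (allFin n)
  solid∈ {y} (zy , yz) = ∈-filter⁺ solid? (∈-allFin y) (subst T (sym (cong₂ _∧_ zy yz)) _)

module _ {n} (i j : Fin n) where

  transpose-ˡ : transpose i j i ≡ j
  transpose-ˡ rewrite dec-true (i ≟ i) refl = refl

  transpose-ʳ : transpose i j j ≡ i
  transpose-ʳ with j ≟ i
  ... | yes j≡i = j≡i
  ... | no _ rewrite dec-true (j ≟ j) refl = refl

  transpose-≢ : ∀ {k} → k ≢ i → k ≢ j → transpose i j k ≡ k
  transpose-≢ {k} k≢i k≢j rewrite dec-false (k ≟ i) k≢i | dec-false (k ≟ j) k≢j = refl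

module TwinSwap {n} (𝒢 : TemporalGraph n) {u v w : Fin n} (u≢v : u ≢ v) (u≢w : u ≢ w)
                (v-pendant : Pendant 𝒢 v u) (w-pendant : Pendant 𝒢 w u)
                (vu⊆wu : ∀ {t} → t ∈ lab 𝒢 v u → t ∈ lab 𝒢 w u)
                (wu⊆vu : ∀ {t} → t ∈ lab 𝒢 w u → t ∈ lab 𝒢 v u) where

  private
    σ : Fin n → Fin n
    σ = transpose v w

    σ-fix : ∀ {x} → x ≢ v → x ≢ w → σ x ≡ x
    σ-fix = transpose-≢ v w

    σ-lab-v : ∀ {b t} → t ∈ lab 𝒢 v b → t ∈ lab 𝒢 (σ v) (σ b)
    σ-lab-v p with refl ← v-pendant p rewrite transpose-ˡ v w | σ-fix u≢v u≢w = vu⊆wu p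

    σ-lab-w : ∀ {b t} → t ∈ lab 𝒢 w b → t ∈ lab 𝒢 (σ w) (σ b)
    σ-lab-w p with refl ← w-pendant p rewrite transpose-ʳ v w | σ-fix u≢v u≢w = wu⊆vu p

    σ-lab-cases : ∀ {a b t} → Dec (a ≡ v) → Dec (a ≡ w) → Dec (b ≡ v) → Dec (b ≡ w) →
                  t ∈ lab 𝒢 a b → t ∈ lab 𝒢 (σ a) (σ b)
    σ-lab-cases (yes refl) _          _          _          p = σ-lab-v p
    σ-lab-cases (no _)     (yes refl) _          _          p = σ-lab-w p
    σ-lab-cases (no _)     (no _)     (yes refl) _          p = ∈-lab-sym 𝒢 (σ-lab-v (∈-lab-sym 𝒢 p))
    σ-lab-cases (no _)     (no _)     (no _)     (yes refl) p = ∈-lab-sym 𝒢 (σ-lab-w (∈-lab-sym 𝒢 p))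
    σ-lab-cases (no a≢v)   (no a≢w)   (no b≢v)   (no b≢w)   p
      rewrite σ-fix a≢v a≢w | σ-fix b≢v b≢w = p

    σ-lab : ∀ {a b t} → t ∈ lab 𝒢 a b → t ∈ lab 𝒢 (σ a) (σ b)
    σ-lab {a} {b} = σ-lab-cases (a ≟ v) (a ≟ w) (b ≟ v) (b ≟ w)

    σ-reach : ∀ {_≺_ a b} → ReachArc 𝒢 _≺_ a b → ReachArc 𝒢 _≺_ (σ a) (σ b)
    σ-reach (_ , _ , vs , wk , un) =
      mapPath σ (transpose w v) {P = U} (λ _ → transpose-inverse w v) (λ _ _ → σ-lab)
              wk un (All.universal-U vs)

  reach-from-twin : ∀ {_≺_ x} → x ≢ v → x ≢ w → ReachArc 𝒢 _≺_ v x → ReachArc 𝒢 _≺_ w x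
  reach-from-twin x≢v x≢w r = subst₂ (ReachArc 𝒢 _) (transpose-ˡ v w) (σ-fix x≢v x≢w) (σ-reach r)

  reach-to-twin : ∀ {_≺_ x} → x ≢ v → x ≢ w → ReachArc 𝒢 _≺_ x v → ReachArc 𝒢 _≺_ x w
  reach-to-twin x≢v x≢w r = subst₂ (ReachArc 𝒢 _) (σ-fix x≢v x≢w) (transpose-ˡ v w) (σ-reach r)

-- A left inverse of punchIn v; its value at v itself is the junk value default.
module _ {m} (v : Fin (suc m)) (default : Fin m) where

  retract : Fin (suc m) → Fin m
  retract a with v ≟ a
  ... | yes _   = default
  ... | no v≢a = punchOut v≢a

  retract-punchIn : ∀ x → retract (punchIn v x) ≡ x
  retract-punchIn x with v ≟ punchIn v x
  ... | yes v≡v↑x = ⊥-elim (punchInᵢ≢i v x (sym v≡v↑x))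
  ... | no _       = trans (punchOut-cong v refl) (punchOut-punchIn v)

  punchIn-retract : ∀ {a} → v ≢ a → punchIn v (retract a) ≡ a
  punchIn-retract {a} v≢a with v ≟ a
  ... | yes v≡a = ⊥-elim (v≢a v≡a)
  ... | no v≢a  = punchIn-punchOut v≢a

module Deletion {m} {𝒢 : TemporalGraph (suc m)} {H : TemporalGraph m} {u v : Fin (suc m)}
                (v≢u : v ≢ u) (v-pendant : Pendant 𝒢 v u)
                (lab-punchIn : ∀ x y → lab 𝒢 (punchIn v x) (punchIn v y) ≡ lab H x y) where

  private
    ρ : Fin (suc m) → Fin m
    ρ = retract v (punchOut v≢u)

  reach-punchIn : ∀ {_≺_ x y} → ReachArc H _≺_ x y ⇔ ReachArc 𝒢 _≺_ (punchIn v x) (punchIn v y)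
  reach-punchIn {_≺_} {x} {y} = mk⇔ via-punchIn via-retract
    where
    via-punchIn : ReachArc H _≺_ x y → ReachArc 𝒢 _≺_ (punchIn v x) (punchIn v y)
    via-punchIn (_ , _ , vs , wk , un) =
      mapPath (punchIn v) ρ {P = U} (λ _ → retract-punchIn v _ _)
              (λ _ _ → subst (_ ∈_) (sym (lab-punchIn _ _))) wk un (All.universal-U vs)

    via-retract : ReachArc 𝒢 _≺_ (punchIn v x) (punchIn v y) → ReachArc H _≺_ x y
    via-retract (_ , _ , _ , wk , un) =
      subst₂ (ReachArc H _≺_) (retract-punchIn v _ x) (retract-punchIn v _ y)
        (mapPath ρ (punchIn v) (punchIn-retract v _) lab-retract wk un
          (pendant-avoided v-pendant wk un (punchInᵢ≢i v x ∘ sym) (punchInᵢ≢i v y ∘ sym)))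
      where
      lab-retract : ∀ {a b t} → v ≢ a → v ≢ b → t ∈ lab 𝒢 a b → t ∈ lab H (ρ a) (ρ b)
      lab-retract v≢a v≢b =
        subst (_ ∈_) (trans (sym (cong₂ (lab 𝒢) (punchIn-retract v _ v≢a) (punchIn-retract v _ v≢b)))
                            (lab-punchIn _ _))

  realizes⁺ : ∀ {_≺_ D} → HasReachGraph 𝒢 _≺_ D → HasReachGraph H _≺_ (deleteVertex D v)
  realizes⁺ realizes x y = ⇔-trans (realizes (punchIn v x) (punchIn v y)) (⇔-sym reach-punchIn)

  realizes⁻ : ∀ {_≺_ D} → HasReachGraph H _≺_ (deleteVertex D v) →
              ∀ {a b} → v ≢ a → v ≢ b → (D a b ≡ true ⇔ ReachArc 𝒢 _≺_ a b)
  realizes⁻ {_≺_} {D} realizes' {a} {b} v≢a v≢b =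
    subst₂ (λ a b → D a b ≡ true ⇔ ReachArc 𝒢 _≺_ a b) (punchIn-retract v _ v≢a) (punchIn-retract v _ v≢b)
           (⇔-trans (realizes' (ρ a) (ρ b)) reach-punchIn)

module AttachPendant {n} (z c : Fin n) (z≢c : z ≢ c) (ℓ : List ℕ) (rest : Fin n → Fin n → List ℕ)
                     (rest-sym : ∀ a b → rest a b ≡ rest b a) (rest-loop : ∀ a → rest a a ≡ []) where

  private
    lab-c : (b : Fin n) → Dec (c ≡ b) → List ℕ
    lab-c _ (yes _) = ℓ
    lab-c _ (no _)  = []

    lab' : (a b : Fin n) → Dec (z ≡ a) → Dec (z ≡ b) → List ℕ
    lab' _ _ (yes _) (yes _) = []
    lab' _ b (yes _) (no _)  = lab-c b (c ≟ b)
    lab' a _ (no _)  (yes _) = lab-c a (c ≟ a)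
    lab' a b (no _)  (no _)  = rest a b

    lab'-sym : ∀ a b da db → lab' a b da db ≡ lab' b a db da
    lab'-sym _ _ (yes _) (yes _) = refl
    lab'-sym _ _ (yes _) (no _)  = refl
    lab'-sym _ _ (no _)  (yes _) = refl
    lab'-sym a b (no _)  (no _)  = rest-sym a b

    lab'-loop : ∀ a da → lab' a a da da ≡ []
    lab'-loop _ (yes _) = refl
    lab'-loop a (no _)  = rest-loop a

  graph : TemporalGraph n
  graph = record
    { lab      = λ a b → lab' a b (z ≟ a) (z ≟ b)
    ; lab-sym  = λ a b → lab'-sym a b (z ≟ a) (z ≟ b)
    ; loopless = λ a → lab'-loop a (z ≟ a)
    }

  private
    ∈-lab-c : ∀ {b t} dc → t ∈ lab-c b dc → b ≡ c × t ∈ ℓ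
    ∈-lab-c (yes c≡b) p = sym c≡b , p

    ∈-lab'-z : ∀ {b t} dz db → t ∈ lab' z b dz db → b ≡ c × t ∈ ℓ
    ∈-lab'-z     (yes _)   (no _) p = ∈-lab-c (c ≟ _) p
    ∈-lab'-z     (no z≢z) _       _ = ⊥-elim (z≢z refl)

    ℓ⊆lab-c : ∀ {t} dc → t ∈ ℓ → t ∈ lab-c c dc
    ℓ⊆lab-c (yes _)  p = p
    ℓ⊆lab-c (no c≢c) _ = ⊥-elim (c≢c refl)

    ℓ⊆lab' : ∀ {t} dz dc → t ∈ ℓ → t ∈ lab' z c dz dc
    ℓ⊆lab' (yes _)  (yes z≡c) _ = ⊥-elim (z≢c z≡c)
    ℓ⊆lab' (yes _)  (no _)    p = ℓ⊆lab-c (c ≟ c) p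
    ℓ⊆lab' (no z≢z) _         _ = ⊥-elim (z≢z refl)

    lab'-away : ∀ {a b} da db → z ≢ a → z ≢ b → lab' a b da db ≡ rest a b
    lab'-away (yes z≡a) _         z≢a _   = ⊥-elim (z≢a z≡a)
    lab'-away (no _)    (yes z≡b) _   z≢b = ⊥-elim (z≢b z≡b)
    lab'-away (no _)    (no _)    _   _   = refl

  ∈-lab-z : ∀ {b t} → t ∈ lab graph z b → b ≡ c × t ∈ ℓ
  ∈-lab-z {b} = ∈-lab'-z (z ≟ z) (z ≟ b)

  pendant : Pendant graph z c
  pendant = proj₁ ∘ ∈-lab-z

  ℓ⊆lab : ∀ {t} → t ∈ ℓ → t ∈ lab graph z c
  ℓ⊆lab = ℓ⊆lab' (z ≟ z) (z ≟ c)

  lab-away : ∀ {a b} → z ≢ a → z ≢ b → lab graph a b ≡ rest a b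
  lab-away {a} {b} = lab'-away (z ≟ a) (z ≟ b)

  simple : (∀ {t t'} → t ∈ ℓ → t' ∈ ℓ → t ≡ t') →
           (∀ a b t t' → t ∈ rest a b → t' ∈ rest a b → t ≡ t') → IsSimpleLabeling graph
  simple ℓ-simple rest-simple a b = simple' (z ≟ a) (z ≟ b)
    where
    simple' : Dec (z ≡ a) → Dec (z ≡ b) → ∀ t t' → t ∈ lab graph a b → t' ∈ lab graph a b → t ≡ t'
    simple' (yes refl) _ _ _ p q = ℓ-simple (proj₂ (∈-lab-z p)) (proj₂ (∈-lab-z q))
    simple' _ (yes refl) _ _ p q =
      ℓ-simple (proj₂ (∈-lab-z (∈-lab-sym graph p))) (proj₂ (∈-lab-z (∈-lab-sym graph q)))
    simple' (no z≢a) (no z≢b) t t' p q =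
      rest-simple a b t t' (subst (t ∈_) (lab-away z≢a z≢b) p) (subst (t' ∈_) (lab-away z≢a z≢b) q)


module _ {n} {𝒢 : TemporalGraph n} {b : Fin n} {s : ℕ} (into-b : ∀ {y t} → t ∈ lab 𝒢 y b → t ≤ s) where

  first-label≤ : ∀ {a t vs} → TWalk 𝒢 _<_ a b t vs → t ≤ s
  first-label≤ (one p)          = into-b p
  first-label≤ (cons _ t<t' rest) = <⇒≤ (<-≤-trans t<t' (first-label≤ rest))

  no-strict-walk : ∀ {a t vs} → (∀ {y t} → t ∈ lab 𝒢 a y → s ≤ t) → (∀ {t} → ¬ t ∈ lab 𝒢 a b) →
                   ¬ TWalk 𝒢 _<_ a b t vs
  no-strict-walk _      not-adjacent (one p)            = not-adjacent p
  no-strict-walk from-a _            (cons p t<t' rest) = <⇒≱ (<-≤-trans t<t' (first-label≤ rest)) (from-a p)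

double : ℕ → ℕ
double t = t + t

double-mono-< : ∀ {t t'} → t < t' → double t < double t'
double-mono-< t<t' = +-mono-< t<t' t<t'

double-cancel-< : ∀ {t t'} → double t < double t' → t < t'
double-cancel-< 2t<2t' = ≰⇒> (λ t'≤t → <⇒≱ 2t<2t' (+-mono-≤ t'≤t t'≤t))

module _ {t₀ : ℕ} {L : List ℕ} (t₀∈L : t₀ ∈ L) where

  min∈ : min t₀ L ∈ L
  min∈ = [ (λ min≡t₀ → subst (_∈ L) (sym min≡t₀) t₀∈L) , id ]′ (argmin-sel id t₀ L)

  max∈ : max t₀ L ∈ L
  max∈ = [ (λ max≡t₀ → subst (_∈ L) (sym max≡t₀) t₀∈L) , id ]′ (argmax-sel id t₀ L)

module BalanceLeaf {n} {E : Digraph n} {u w : Fin n} (w≢u : w ≢ u)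
                   (w-solid : ∀ {x} → SolidEdge E w x → x ≡ u) (wu : E w u ≡ true)
                   {𝒢 : TemporalGraph n} (realizes : HasReachGraph 𝒢 _<_ E) where

  open Realization realizes

  private
    w-pendant : Pendant 𝒢 w u
    w-pendant = solid⇒pendant w-solid

    L : List ℕ
    L = lab 𝒢 w u

    t₀ : ℕ
    t₀ = proj₁ (pendant-arc⇒label w-pendant wu)

    t₀∈L : t₀ ∈ L
    t₀∈L = proj₂ (pendant-arc⇒label w-pendant wu)

    l₁ lₖ : ℕ
    l₁ = min t₀ L
    lₖ = max t₀ L

    l₁∈ : l₁ ∈ L
    l₁∈ = min∈ t₀∈L

    lₖ∈ : lₖ ∈ L
    lₖ∈ = max∈ t₀∈L

    l₁≤ : ∀ {t} → t ∈ L → l₁ ≤ t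
    l₁≤ = All.lookup (min≤xs t₀ L)

    ≤lₖ : ∀ {t} → t ∈ L → t ≤ lₖ
    ≤lₖ = All.lookup (xs≤max t₀ L)

  s : ℕ
  s = l₁ + lₖ

  private
    module P = AttachPendant w u w≢u (s ∷ []) (λ a b → map double (lab 𝒢 a b))
                             (λ a b → cong (map double) (lab-sym 𝒢 a b)) (λ a → cong (map double) (loopless 𝒢 a))

  H : TemporalGraph n
  H = P.graph

  H-pendant : Pendant H w u
  H-pendant = P.pendant

  H-labels-at-w : ∀ {y t} → t ∈ lab H w y → t ≡ s
  H-labels-at-w p with P.∈-lab-z p
  ... | _ , here t≡s = t≡s

  H-simple : IsSimpleLabeling 𝒢 → IsSimpleLabeling H
  H-simple 𝒢-simple = P.simple (λ { (here refl) (here refl) → refl }) doubled-simple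
    where
    doubled-simple : ∀ a b t t' → t ∈ map double (lab 𝒢 a b) → t' ∈ map double (lab 𝒢 a b) → t ≡ t'
    doubled-simple a b _ _ p q with ∈-map⁻ double p | ∈-map⁻ double q
    ... | t₀ , p₀ , refl | t₀' , q₀ , refl = cong double (𝒢-simple a b t₀ t₀' p₀ q₀)

  private
    lₖ≤out : ∀ {z t} → z ≢ w → E w z ≡ true → t ∈ lab 𝒢 u z → lₖ ≤ t
    lₖ≤out z≢w wz p = ≮⇒≥ λ t<lₖ →
      ∈-lab⇒≢ 𝒢 p (sym (w-solid (wz , reach⇒arc
        (twoEdges⇒reach 𝒢 _<_ (∈-lab-sym 𝒢 p) t<lₖ (∈-lab-sym 𝒢 lₖ∈) z≢w))))

    in≤l₁ : ∀ {a t} → a ≢ w → E a w ≡ true → t ∈ lab 𝒢 a u → t ≤ l₁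
    in≤l₁ a≢w aw p = ≮⇒≥ λ l₁<t →
      ∈-lab⇒≢ 𝒢 p (w-solid (reach⇒arc (twoEdges⇒reach 𝒢 _<_ l₁∈ l₁<t (∈-lab-sym 𝒢 p) (a≢w ∘ sym)) , aw))

    double∈ : ∀ {a b t} → w ≢ a → w ≢ b → t ∈ lab 𝒢 a b → double t ∈ lab H a b
    double∈ w≢a w≢b p = subst (_ ∈_) (sym (P.lab-away w≢a w≢b)) (∈-map⁺ double p)

    halve∈ : ∀ {a b t} → w ≢ a → w ≢ b → t ∈ lab H a b → ∃ λ t₀ → t ≡ double t₀ × t₀ ∈ lab 𝒢 a b
    halve∈ w≢a w≢b p with ∈-map⁻ double (subst (_ ∈_) (P.lab-away w≢a w≢b) p)
    ... | t₀ , p₀ , t≡2t₀ = t₀ , t≡2t₀ , p₀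

    away⁺ : ∀ {a b t vs} → TWalk 𝒢 _<_ a b t vs → All (w ≢_) vs → TWalk H _<_ a b (double t) vs
    away⁺ {a} {b} {t} {vs} wk avoids
      with mapTWalk id {R = λ t t' → t' ≡ double t} (λ w≢a w≢b p → _ , refl , double∈ w≢a w≢b p)
                    (λ { refl refl → double-mono-< }) wk avoids
    ... | _ , refl , wk' = subst (TWalk H _<_ a b (double t)) (map-id vs) wk'

    away⁻ : ∀ {a b t vs} → TWalk H _<_ a b t vs → All (w ≢_) vs →
            ∃ λ t₀ → t ≡ double t₀ × TWalk 𝒢 _<_ a b t₀ vs
    away⁻ {a} {b} {vs = vs} wk avoids
      with mapTWalk id {R = λ t t₀ → t ≡ double t₀} halve∈ (λ { refl refl → double-cancel-< }) wk avoids
    ... | t₀ , t≡2t₀ , wk' = t₀ , t≡2t₀ , subst (TWalk 𝒢 _<_ a b t₀) (map-id vs) wk'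

    s∈H : s ∈ lab H w u
    s∈H = P.ℓ⊆lab (here refl)

    depart⁺ : ∀ {b t vs} → TWalk 𝒢 _<_ w b t vs → Unique vs → TPath H _<_ w b
    depart⁺ (one p) un with refl ← w-pendant p = s , _ , one s∈H , un
    depart⁺ (cons p t<t' rest) un@(w∉ ∷ _) with refl ← w-pendant p with firstEdge rest
    ... | z , q , z∈ =
      s , _ , cons s∈H (+-mono-<-≤ l₁<t' (lₖ≤out (w≢z ∘ sym) (reach⇒arc w⇝z) q)) (away⁺ rest w∉) , un
      where
      w≢z = All.lookup w∉ z∈
      l₁<t' = ≤-<-trans (l₁≤ p) t<t'
      w⇝z = twoEdges⇒reach 𝒢 _<_ l₁∈ l₁<t' q w≢z

    depart⁻ : ∀ {b t vs} → TWalk H _<_ w b t vs → Unique vs → TPath 𝒢 _<_ w b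
    depart⁻ (one p) un with refl ← H-pendant p = l₁ , _ , one l₁∈ , un
    depart⁻ (cons p t<t' rest) un@(w∉ ∷ _) with refl ← H-pendant p | refl ← H-labels-at-w p | away⁻ rest w∉
    ... | t₀ , refl , rest' =
      l₁ , _ , cons l₁∈ (double-cancel-< (≤-<-trans (+-monoʳ-≤ l₁ (l₁≤ lₖ∈)) t<t')) rest' , un

    arrive-cons⁺ : ∀ {a y t t' vs} → t ∈ lab 𝒢 a y → t < t' → TWalk 𝒢 _<_ y w t' vs → Unique (a ∷ vs) →
                   TWalk H _<_ a w (double t) (a ∷ vs)
    arrive-cons⁺ p t<t' (one q) (a∉ ∷ _) with refl ← w-pendant (∈-lab-sym 𝒢 q) =
      cons (double∈ (a≢w ∘ sym) w≢u p) (+-mono-≤-< t≤l₁ t<lₖ) (one (∈-lab-sym H s∈H))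
      where
      a≢w = All.lookup a∉ (there (here refl))
      t≤l₁ = in≤l₁ a≢w (reach⇒arc (twoEdges⇒reach 𝒢 _<_ p t<t' q a≢w)) p
      t<lₖ = <-≤-trans t<t' (≤lₖ (∈-lab-sym 𝒢 q))
    arrive-cons⁺ p t<t' rest@(cons q t'<t'' rest') (a∉ ∷ un) =
      cons (double∈ (All.lookup a∉ (target∈ rest) ∘ sym) (endpoints-≢ rest un ∘ sym) p)
           (double-mono-< t<t') (arrive-cons⁺ q t'<t'' rest' un)

    arrive-cons⁻ : ∀ {a y t t' vs} → t ∈ lab H a y → t < t' → TWalk H _<_ y w t' vs → Unique (a ∷ vs) →
                   ∃ λ t₀ → t ≡ double t₀ × TWalk 𝒢 _<_ a w t₀ (a ∷ vs)
    arrive-cons⁻ p t<t' (one q) (a∉ ∷ _)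
      with refl ← H-pendant (∈-lab-sym H q) | refl ← H-labels-at-w (∈-lab-sym H q)
         | halve∈ (All.lookup a∉ (there (here refl)) ∘ sym) w≢u p
    ... | t₀ , refl , p₀ =
      t₀ , refl , cons p₀ (double-cancel-< (<-≤-trans t<t' (+-monoˡ-≤ lₖ (l₁≤ lₖ∈)))) (one (∈-lab-sym 𝒢 lₖ∈))
    arrive-cons⁻ p t<t' rest@(cons q t'<t'' rest') (a∉ ∷ un)
      with arrive-cons⁻ q t'<t'' rest' un
         | halve∈ (All.lookup a∉ (target∈ rest) ∘ sym) (endpoints-≢ rest un ∘ sym) p
    ... | _ , refl , rest'' | t₀ , refl , p₀ = t₀ , refl , cons p₀ (double-cancel-< t<t') rest''

    arrive⁺ : ∀ {a t vs} → TWalk 𝒢 _<_ a w t vs → Unique vs → TPath H _<_ a w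
    arrive⁺ (one p) un with refl ← w-pendant (∈-lab-sym 𝒢 p) = s , _ , one (∈-lab-sym H s∈H) , un
    arrive⁺ (cons p t<t' rest) un = _ , _ , arrive-cons⁺ p t<t' rest un , un

    arrive⁻ : ∀ {a t vs} → TWalk H _<_ a w t vs → Unique vs → TPath 𝒢 _<_ a w
    arrive⁻ (one p) un with refl ← H-pendant (∈-lab-sym H p) = lₖ , _ , one (∈-lab-sym 𝒢 lₖ∈) , un
    arrive⁻ (cons p t<t' rest) un = _ , _ , proj₂ (proj₂ (arrive-cons⁻ p t<t' rest un)) , un

    path⁺ : ∀ {a b t vs} → Dec (w ≡ a) → Dec (w ≡ b) → TWalk 𝒢 _<_ a b t vs → Unique vs → TPath H _<_ a b
    path⁺ (yes refl) _          = depart⁺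
    path⁺ (no _)     (yes refl) = arrive⁺
    path⁺ (no w≢a)   (no w≢b) wk un = _ , _ , away⁺ wk (pendant-avoided w-pendant wk un w≢a w≢b) , un

    path⁻ : ∀ {a b t vs} → Dec (w ≡ a) → Dec (w ≡ b) → TWalk H _<_ a b t vs → Unique vs → TPath 𝒢 _<_ a b
    path⁻ (yes refl) _          = depart⁻
    path⁻ (no _)     (yes refl) = arrive⁻
    path⁻ (no w≢a)   (no w≢b) wk un =
      _ , _ , proj₂ (proj₂ (away⁻ wk (pendant-avoided H-pendant wk un w≢a w≢b))) , un

  H-realizes : HasReachGraph H _<_ E
  H-realizes a b = ⇔-trans (realizes a b) (mk⇔
    (λ { (a≢b , _ , _ , wk , un) → a≢b , path⁺ (w ≟ a) (w ≟ b) wk un })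
    (λ { (a≢b , _ , _ , wk , un) → a≢b , path⁻ (w ≟ a) (w ≟ b) wk un }))

≡true-ext : ∀ {a b : Bool} → (a ≡ true → b ≡ true) → (b ≡ true → a ≡ true) → a ≡ b
≡true-ext {false} {false} _ _ = refl
≡true-ext {false} {true}  _ g = g refl
≡true-ext {true}  {false} f _ = sym (f refl)
≡true-ext {true}  {true}  _ _ = refl

removeVertex : ∀ {m} → TemporalGraph (suc m) → Fin (suc m) → TemporalGraph m
removeVertex 𝒢 v = record
  { lab      = λ x y → lab 𝒢 (punchIn v x) (punchIn v y)
  ; lab-sym  = λ x y → lab-sym 𝒢 (punchIn v x) (punchIn v y)
  ; loopless = λ x → loopless 𝒢 (punchIn v x)
  }

KindOK-map : ∀ {n n'} {G : TemporalGraph n} {H : TemporalGraph n'} →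
             (IsSimpleLabeling G → IsSimpleLabeling H) → ∀ k → KindOK k G → KindOK k H
KindOK-map _ Any    _        = tt
KindOK-map f Simple G-simple = f G-simple

module TwinLeaves {m} (D : Digraph (suc m)) {u v w : Fin (suc m)}
                  (D-simple : IsSimpleDigraph D) (v≢w : v ≢ w)
                  (uv : SolidEdge D u v) (uw : SolidEdge D u w)
                  (deg-v : solidDegree D v ≡ 1) (deg-w : solidDegree D w ≡ 1)
                  (¬vw : D v w ≡ false) (¬wv : D w v ≡ false) where

  private
    no-arc : ∀ {a b} → D a b ≡ false → ¬ D a b ≡ true
    no-arc ¬ab ab with () ← trans (sym ¬ab) ab

    v-solid : ∀ {x} → SolidEdge D v x → x ≡ u
    v-solid = solidDegree1⇒unique D deg-v (proj₂ uv , proj₁ uv)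

    w-solid : ∀ {x} → SolidEdge D w x → x ≡ u
    w-solid = solidDegree1⇒unique D deg-w (proj₂ uw , proj₁ uw)

    u≢v : u ≢ v
    u≢v refl = no-arc (D-simple u) (proj₁ uv)

    u≢w : u ≢ w
    u≢w refl = no-arc (D-simple u) (proj₁ uw)

  module Realizer {𝒢 : TemporalGraph (suc m)} {_≺_ : ℕ → ℕ → Set} (realizes : HasReachGraph 𝒢 _≺_ D) where
    open Realization realizes public

    v-pendant : Pendant 𝒢 v u
    v-pendant = solid⇒pendant v-solid

    w-pendant : Pendant 𝒢 w u
    w-pendant = solid⇒pendant w-solid

    ordered⇒arc : ∀ {a b t t'} → a ≢ b → t ∈ lab 𝒢 a u → t ≺ t' → t' ∈ lab 𝒢 b u → D a b ≡ true
    ordered⇒arc a≢b p t≺t' q = reach⇒arc (twoEdges⇒reach 𝒢 _≺_ p t≺t' (∈-lab-sym 𝒢 q) a≢b)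

    ¬total : ¬ (∀ t t' → t ≺ t' ⊎ t' ≺ t)
    ¬total total with pendant-arc⇒label v-pendant (proj₂ uv) | pendant-arc⇒label w-pendant (proj₂ uw)
    ... | t , p | t' , q with total t t'
    ...   | inj₁ t≺t' = no-arc ¬vw (ordered⇒arc v≢w p t≺t' q)
    ...   | inj₂ t'≺t = no-arc ¬wv (ordered⇒arc (v≢w ∘ sym) q t'≺t p)

  module StrictRealizer {𝒢 : TemporalGraph (suc m)} (realizes : HasReachGraph 𝒢 _<_ D) where
    open Realizer realizes

    private
      labels-agree : ∀ {t t'} → t ∈ lab 𝒢 v u → t' ∈ lab 𝒢 w u → t ≡ t'
      labels-agree {t} {t'} p q with <-cmp t t'
      ... | tri< t<t' _ _ = ⊥-elim (no-arc ¬vw (ordered⇒arc v≢w p t<t' q))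
      ... | tri≈ _ t≡t' _ = t≡t'
      ... | tri> _ _ t'<t = ⊥-elim (no-arc ¬wv (ordered⇒arc (v≢w ∘ sym) q t'<t p))

      vu⊆wu : ∀ {t} → t ∈ lab 𝒢 v u → t ∈ lab 𝒢 w u
      vu⊆wu p with pendant-arc⇒label w-pendant (proj₂ uw)
      ... | _ , q = subst (λ t → t ∈ lab 𝒢 w u) (sym (labels-agree p q)) q

      wu⊆vu : ∀ {t} → t ∈ lab 𝒢 w u → t ∈ lab 𝒢 v u
      wu⊆vu q with pendant-arc⇒label v-pendant (proj₂ uv)
      ... | _ , p = subst (λ t → t ∈ lab 𝒢 v u) (labels-agree p q) p

      module v↦w = TwinSwap 𝒢 u≢v u≢w v-pendant w-pendant vu⊆wu wu⊆vu
      module w↦v = TwinSwap 𝒢 u≢w u≢v w-pendant v-pendant wu⊆vu vu⊆wu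

    twins : Twins D v w
    twins x x≢v x≢w =
      ≡true-ext (reach⇒arc ∘ v↦w.reach-from-twin x≢v x≢w ∘ arc⇒reach)
                (reach⇒arc ∘ w↦v.reach-from-twin x≢w x≢v ∘ arc⇒reach) ,
      ≡true-ext (reach⇒arc ∘ v↦w.reach-to-twin x≢v x≢w ∘ arc⇒reach)
                (reach⇒arc ∘ w↦v.reach-to-twin x≢w x≢v ∘ arc⇒reach)

    removeVertex-realizes : HasReachGraph (removeVertex 𝒢 v) _<_ (deleteVertex D v)
    removeVertex-realizes =
      Deletion.realizes⁺ {𝒢 = 𝒢} {H = removeVertex 𝒢 v} (u≢v ∘ sym) v-pendant (λ _ _ → refl) realizes

  module TwinExtension (twins : Twins D v w) {H₀ : TemporalGraph m}
                       (realizes₀ : HasReachGraph H₀ _<_ (deleteVertex D v)) where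

    private
      v≢u : v ≢ u
      v≢u = u≢v ∘ sym

      ρ : Fin (suc m) → Fin m
      ρ = retract v (punchOut v≢u)

      w' u' : Fin m
      w' = ρ w
      u' = ρ u

      ↑w' : punchIn v w' ≡ w
      ↑w' = punchIn-retract v _ v≢w

      ↑u' : punchIn v u' ≡ u
      ↑u' = punchIn-retract v _ v≢u

      w'≢u' : w' ≢ u'
      w'≢u' w'≡u' = u≢w (trans (sym ↑u') (trans (cong (punchIn v) (sym w'≡u')) ↑w'))

      w'-solid : ∀ {x} → SolidEdge (deleteVertex D v) w' x → x ≡ u'
      w'-solid {x} (w'x , xw') =
        trans (sym (retract-punchIn v _ x))
              (cong ρ (w-solid (subst (λ a → D a (punchIn v x) ≡ true) ↑w' w'x ,
                                subst (λ a → D (punchIn v x) a ≡ true) ↑w' xw')))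

      w'u' : deleteVertex D v w' u' ≡ true
      w'u' = subst₂ (λ a b → D a b ≡ true) (sym ↑w') (sym ↑u') (proj₂ uw)

      module B = BalanceLeaf w'≢u' w'-solid w'u' realizes₀

      H : TemporalGraph m
      H = B.H

      module P = AttachPendant v u v≢u (lab H w' u') (λ a b → lab H (ρ a) (ρ b))
                               (λ a b → lab-sym H (ρ a) (ρ b)) (λ a → loopless H (ρ a))

    𝒢 : TemporalGraph (suc m)
    𝒢 = P.graph

    private
      lab-punchIn : ∀ x y → lab 𝒢 (punchIn v x) (punchIn v y) ≡ lab H x y
      lab-punchIn x y = trans (P.lab-away (punchInᵢ≢i v x ∘ sym) (punchInᵢ≢i v y ∘ sym))
                              (cong₂ (lab H) (retract-punchIn v _ x) (retract-punchIn v _ y))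

      wu≡w'u' : lab 𝒢 w u ≡ lab H w' u'
      wu≡w'u' = P.lab-away v≢w v≢u

      w-pendant-cases : ∀ {y t} → Dec (v ≡ y) → t ∈ lab 𝒢 w y → y ≡ u
      w-pendant-cases (yes refl) p = ⊥-elim (u≢w (sym (proj₁ (P.∈-lab-z (∈-lab-sym 𝒢 p)))))
      w-pendant-cases (no v≢y)   p = trans (sym (punchIn-retract v _ v≢y))
        (trans (cong (punchIn v) (B.H-pendant (subst (_ ∈_) (P.lab-away v≢w v≢y) p))) ↑u')

      w-pendant : Pendant 𝒢 w u
      w-pendant = w-pendant-cases (v ≟ _)

      vu⊆wu : ∀ {t} → t ∈ lab 𝒢 v u → t ∈ lab 𝒢 w u
      vu⊆wu p = subst (_ ∈_) (sym wu≡w'u') (proj₂ (P.∈-lab-z p))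

      wu⊆vu : ∀ {t} → t ∈ lab 𝒢 w u → t ∈ lab 𝒢 v u
      wu⊆vu q = P.ℓ⊆lab (subst (_ ∈_) wu≡w'u' q)

      labels-at-v : ∀ {y t} → t ∈ lab 𝒢 v y → t ≡ B.s
      labels-at-v p = B.H-labels-at-w (proj₂ (P.∈-lab-z p))

      labels-at-w : ∀ {y t} → t ∈ lab 𝒢 w y → t ≡ B.s
      labels-at-w p with refl ← w-pendant p = B.H-labels-at-w (subst (_ ∈_) wu≡w'u' p)

      v↛w : ¬ ReachArc 𝒢 _<_ v w
      v↛w (_ , _ , _ , wk , _) =
        no-strict-walk (≤-reflexive ∘ labels-at-w ∘ ∈-lab-sym 𝒢) (≤-reflexive ∘ sym ∘ labels-at-v)
                       (λ p → u≢w (sym (P.pendant p))) wk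

      w↛v : ¬ ReachArc 𝒢 _<_ w v
      w↛v (_ , _ , _ , wk , _) =
        no-strict-walk (≤-reflexive ∘ labels-at-v ∘ ∈-lab-sym 𝒢) (≤-reflexive ∘ sym ∘ labels-at-w)
                       (λ p → u≢v (sym (w-pendant p))) wk

      module v↦w = TwinSwap 𝒢 u≢v u≢w P.pendant w-pendant vu⊆wu wu⊆vu
      module w↦v = TwinSwap 𝒢 u≢w u≢v w-pendant P.pendant wu⊆vu vu⊆wu

      arcs-away : ∀ {a b} → v ≢ a → v ≢ b → (D a b ≡ true ⇔ ReachArc 𝒢 _<_ a b)
      arcs-away = Deletion.realizes⁻ {𝒢 = 𝒢} {H = H} v≢u P.pendant lab-punchIn B.H-realizes

      arcs-from-v : ∀ {b} → v ≢ b → Dec (w ≡ b) → (D v b ≡ true ⇔ ReachArc 𝒢 _<_ v b)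
      arcs-from-v _ (yes refl) = mk⇔ (⊥-elim ∘ no-arc ¬vw) (⊥-elim ∘ v↛w)
      arcs-from-v {b} v≢b (no w≢b) = mk⇔
        (w↦v.reach-from-twin b≢w b≢v ∘ Equivalence.to (arcs-away v≢w v≢b) ∘ subst (_≡ true) D-vb≡D-wb)
        (subst (_≡ true) (sym D-vb≡D-wb) ∘ Equivalence.from (arcs-away v≢w v≢b)
                                          ∘ v↦w.reach-from-twin b≢v b≢w)
        where
        b≢v = v≢b ∘ sym
        b≢w = w≢b ∘ sym
        D-vb≡D-wb = proj₁ (twins b b≢v b≢w)

      arcs-to-v : ∀ {a} → v ≢ a → Dec (w ≡ a) → (D a v ≡ true ⇔ ReachArc 𝒢 _<_ a v)
      arcs-to-v _ (yes refl) = mk⇔ (⊥-elim ∘ no-arc ¬wv) (⊥-elim ∘ w↛v)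
      arcs-to-v {a} v≢a (no w≢a) = mk⇔
        (w↦v.reach-to-twin a≢w a≢v ∘ Equivalence.to (arcs-away v≢a v≢w) ∘ subst (_≡ true) D-av≡D-aw)
        (subst (_≡ true) (sym D-av≡D-aw) ∘ Equivalence.from (arcs-away v≢a v≢w)
                                          ∘ v↦w.reach-to-twin a≢v a≢w)
        where
        a≢v = v≢a ∘ sym
        a≢w = w≢a ∘ sym
        D-av≡D-aw = proj₂ (twins a a≢v a≢w)

      arcs : ∀ a b → Dec (v ≡ a) → Dec (v ≡ b) → (D a b ≡ true ⇔ ReachArc 𝒢 _<_ a b)
      arcs _ _ (yes refl) (yes refl) = mk⇔ (⊥-elim ∘ no-arc (D-simple v)) (λ r → ⊥-elim (proj₁ r refl))
      arcs _ b (yes refl) (no v≢b)   = arcs-from-v v≢b (w ≟ b)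
      arcs a _ (no v≢a)   (yes refl) = arcs-to-v v≢a (w ≟ a)
      arcs _ _ (no v≢a)   (no v≢b)   = arcs-away v≢a v≢b

    realizes : HasReachGraph 𝒢 _<_ D
    realizes a b = arcs a b (v ≟ a) (v ≟ b)

    simple : IsSimpleLabeling H₀ → IsSimpleLabeling 𝒢
    simple H₀-simple = P.simple (λ p q → trans (B.H-labels-at-w p) (sym (B.H-labels-at-w q)))
                                (λ a b → B.H-simple H₀-simple (ρ a) (ρ b))

  realizable-deleteVertex⁺ : ∀ k → Realizable (strict k) D → Realizable (strict k) (deleteVertex D v)
  realizable-deleteVertex⁺ k (𝒢 , ok , realizes) =
    removeVertex 𝒢 v , KindOK-map (λ 𝒢-simple x y → 𝒢-simple (punchIn v x) (punchIn v y)) k ok ,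
    StrictRealizer.removeVertex-realizes realizes

  realizable-deleteVertex⁻ : ∀ k → Twins D v w →
                             Realizable (strict k) (deleteVertex D v) → Realizable (strict k) D
  realizable-deleteVertex⁻ k twins (_ , ok , realizes₀) =
    TwinExtension.𝒢 twins realizes₀ , KindOK-map (TwinExtension.simple twins realizes₀) k ok ,
    TwinExtension.realizes twins realizes₀

lemma17 : (m : ℕ) (D : Digraph (suc m)) (u v w : Fin (suc m)) →
          IsSimpleDigraph D →
          v ≢ w →
          SolidEdge D u v → SolidEdge D u w →
          solidDegree D v ≡ 1 → solidDegree D w ≡ 1 →
          D v w ≡ false → D w v ≡ false →
          ((k : Kind) → ¬ Realizable (nonStrict k) D)
          × ¬ Realizable proper D
          × ¬ Realizable happy D
          × ((k : Kind) →
               (Twins D v w → (Realizable (strict k) D ⇔ Realizable (strict k) (deleteVertex D v)))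
               × (¬ Twins D v w → ¬ Realizable (strict k) D))
lemma17 m D u v w D-simple v≢w uv uw deg-v deg-w ¬vw ¬wv =
    (λ { _ (_ , _ , realizes) → Realizer.¬total realizes ≤-total })
  , (λ { (_ , _ , realizes) → Realizer.¬total realizes ≤-total })
  , (λ { (_ , _ , realizes) → Realizer.¬total realizes ≤-total })
  , λ k → (λ twins → mk⇔ (realizable-deleteVertex⁺ k) (realizable-deleteVertex⁻ k twins))
        , (λ { ¬twins (_ , _ , realizes) → ¬twins (StrictRealizer.twins realizes) })
  where open TwinLeaves D D-simple v≢w uv uw deg-v deg-w ¬vw ¬wv
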